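{- Let $\mathbf{ILX}$ be a logic extending $\mathbf{IL}$, $\Gamma,\Delta$ $\mathbf{ILX}$-MCSs and $S$ a set of formulas such that $A\rhd B\in\Gamma$, $\Gamma\prec_S\Delta$ and $A\in\Delta$. Then there is an $\mathbf{ILX}$-MCS $\Delta'$ such that $\Gamma\prec_S\Delta'$ and $B,\Box\neg B\in\Delta'$.
   Context: Formulas: $\bot$, propositional variables, $\to$, $\Box$, binary $\rhd$; $\Diamond A:=\neg\Box\neg A$. $\mathbf{IL}$: classical tautologies, K, L: $\Box(\Box A\to A)\to\Box A$, J1: $\Box(A\to B)\to A\rhd B$, J2: $(A\rhd B)\wedge(B\rhd C)\to A\rhd C$, J3: $(A\rhd C)\wedge(B\rhd C)\to A\vee B\rhd C$, J4: $A\rhd B\to(\Diamond A\to\Diamond B)$, J5: $\Diamond A\rhd A$; rules modus ponens and necessitation. An $\mathbf{ILX}$-MCS is a maximal $\mathbf{ILX}$-consistent set. $\Gamma\prec_S\Delta$ iff for every formula $A$ and finite $S'\subseteq S$, $\neg A\rhd\bigvee_{\sigma\in S'}\neg\sigma\in\Gamma$ implies $A,\Box A\in\Delta$ (empty disjunction is $\bot$). -}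

module Defs where

open import Data.Nat using (ℕ)
open import Data.Bool using (Bool; true; false; _∧_; _∨_; not)
open import Data.List using (List; []; _∷_; map)
open import Data.List.Relation.Unary.All using (All)
open import Data.Product using (Σ; _×_)
open import Relation.Binary.PropositionalEquality using (_≡_)
open import Relation.Nullary using (¬_)

infixr 6 _⇒_
infix 7 _▷_
infixr 8 _∨'_ _∧'_

data Fm : Set where
  ⊥' : Fm
  var : ℕ → Fm
  _⇒_ : Fm → Fm → Fm
  □ : Fm → Fm
  _▷_ : Fm → Fm → Fm

~ : Fm → Fm
~ A = A ⇒ ⊥'

⊤' : Fm
⊤' = ⊥' ⇒ ⊥'

_∨'_ : Fm → Fm → Fm
A ∨' B = ~ A ⇒ B

_∧'_ : Fm → Fm → Fm
A ∧' B = ~ (A ⇒ ~ B)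

◇ : Fm → Fm
◇ A = ~ (□ (~ A))

⋁ : List Fm → Fm
⋁ [] = ⊥'
⋁ (A ∷ As) = A ∨' ⋁ As

⋀ : List Fm → Fm
⋀ [] = ⊤'
⋀ (A ∷ As) = A ∧' ⋀ As

-- Classical tautologies: formulas true under every Boolean valuation in which
-- variables, □-formulas and ▷-formulas are treated as atoms.
eval : (Fm → Bool) → Fm → Bool
eval v ⊥' = false
eval v (var i) = v (var i)
eval v (A ⇒ B) = not (eval v A) ∨ eval v B
eval v (□ A) = v (□ A)
eval v (A ▷ B) = v (A ▷ B)

Tautology : Fm → Set
Tautology A = (v : Fm → Bool) → eval v A ≡ true

data _⊢_ (X : Fm → Set) : Fm → Set where
  taut : ∀ {A} → Tautology A → X ⊢ A
  axK  : ∀ {A B} → X ⊢ (□ (A ⇒ B) ⇒ (□ A ⇒ □ B))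
  axL  : ∀ {A} → X ⊢ (□ (□ A ⇒ A) ⇒ □ A)
  axJ1 : ∀ {A B} → X ⊢ (□ (A ⇒ B) ⇒ A ▷ B)
  axJ2 : ∀ {A B C} → X ⊢ ((A ▷ B) ∧' (B ▷ C) ⇒ A ▷ C)
  axJ3 : ∀ {A B C} → X ⊢ ((A ▷ C) ∧' (B ▷ C) ⇒ (A ∨' B) ▷ C)
  axJ4 : ∀ {A B} → X ⊢ (A ▷ B ⇒ (◇ A ⇒ ◇ B))
  axJ5 : ∀ {A} → X ⊢ (◇ A ▷ A)
  axX  : ∀ {A} → X A → X ⊢ A
  mp   : ∀ {A B} → X ⊢ (A ⇒ B) → X ⊢ A → X ⊢ B
  nec  : ∀ {A} → X ⊢ A → X ⊢ □ A

FmSet : Set₁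
FmSet = Fm → Set

_⊆_ : FmSet → FmSet → Set
Γ ⊆ Θ = ∀ {A} → Γ A → Θ A

Consistent : (Fm → Set) → FmSet → Set
Consistent X Γ = ¬ (Σ (List Fm) λ Γ' → All Γ Γ' × (X ⊢ ~ (⋀ Γ')))

MCS : (Fm → Set) → FmSet → Set₁
MCS X Γ = Consistent X Γ × ((Θ : FmSet) → Γ ⊆ Θ → Consistent X Θ → Θ ⊆ Γ)

_≺[_]_ : FmSet → FmSet → FmSet → Set
Γ ≺[ S ] Δ = (A : Fm) (S' : List Fm) → All S S' →
  Γ (~ A ▷ ⋁ (map ~ S')) → Δ A × Δ (□ A)

module Submission where

-- Call D "S-critical for Γ" when ¬D ▷ ⋁¬S' ∈ Γ for a finite S' ⊆ S; then
-- Γ ≺_S Δ' says exactly that Δ' contains every critical D and □D.  The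
-- critical formulas are closed under ⊤, ∧ and □, so it suffices to extend the
-- seed  {B, □¬B} ∪ critical  to an MCS.  The seed is consistent: otherwise
-- B ∧ □¬B ⊢ ¬D for a critical D, and the chain
--   ¬¬A ▷ A ▷ B ▷ B ∧ □¬B ▷ ¬D ▷ ⋁¬S'
-- (the third step is the Löb-style IL theorem B ▷ B ∧ □¬B) makes ¬A critical,
-- putting ¬A next to A in Δ.

open import Defs
open import Data.Bool using (Bool; true; false; not; T) renaming (_∧_ to _and_; _∨_ to _or_)
open import Data.Bool.Properties using (T-∧; T-≡)
open import Data.Empty using (⊥)
open import Data.Fin using (Fin; zero; suc)
open import Data.List using (List; []; _∷_; _++_; map; foldl)
open import Data.List.Properties using (map-++; ∷-injectiveˡ)
open import Data.List.Relation.Unary.All using (All; []; _∷_)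
import Data.List.Relation.Unary.All as All
open import Data.List.Relation.Unary.All.Properties using (++⁺)
open import Data.Nat using (ℕ; zero; suc; _+_; _⊔_; _≤′_; ≤′-refl; ≤′-step)
open import Data.Nat.Binary using (ℕᵇ; 2[1+_]; 1+[2_]; toℕ) renaming (zero to 0ᵇ)
open import Data.Nat.Binary.Properties using (toℕ-injective; 2[1+_]-injective; 1+[2_]-injective)
open import Data.Nat.Properties using (m≤m⊔n; m≤n⊔m; ≤⇒≤′)
open import Data.Product using (Σ; _×_; _,_; proj₁; proj₂)
open import Data.Sum using (_⊎_; inj₁; inj₂)
open import Data.Vec using (Vec; []; _∷_; lookup)
import Data.Vec as Vec
open import Data.Vec.Properties using (lookup-map)
open import Function using (_∘_; _$_)
open import Function.Bundles using (Equivalence)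
open import Relation.Binary.PropositionalEquality using (_≡_; refl; sym; trans; cong; cong₂; subst; module ≡-Reasoning)

private
  variable
    X : Fm → Set
    Γ Δ Θ S : FmSet
    A B D E P Q R : Fm
    n : ℕ

data Schema (n : ℕ) : Set where
  ⊥ₛ    : Schema n
  ‵_    : Fin n → Schema n
  _⇒ₛ_ : Schema n → Schema n → Schema n

infixr 6 _⇒ₛ_
infixr 8 _∧ₛ_ _∨ₛ_

-- Derived connectives, mirroring those of Defs so that instantiation
-- commutes with them definitionally.
~ₛ : Schema n → Schema n
~ₛ P = P ⇒ₛ ⊥ₛ

⊤ₛ : Schema n
⊤ₛ = ⊥ₛ ⇒ₛ ⊥ₛ

_∧ₛ_ _∨ₛ_ : Schema n → Schema n → Schema n
P ∧ₛ Q = ~ₛ (P ⇒ₛ ~ₛ Q)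
P ∨ₛ Q = ~ₛ P ⇒ₛ Q

x₀ : Schema (1 + n)
x₀ = ‵ zero

x₁ : Schema (2 + n)
x₁ = ‵ suc zero

x₂ : Schema (3 + n)
x₂ = ‵ suc (suc zero)

x₃ : Schema (4 + n)
x₃ = ‵ suc (suc (suc zero))

x₄ : Schema (5 + n)
x₄ = ‵ suc (suc (suc (suc zero)))

instantiate : Vec Fm n → Schema n → Fm
instantiate σ ⊥ₛ       = ⊥'
instantiate σ (‵ i)    = lookup σ i
instantiate σ (P ⇒ₛ Q) = instantiate σ P ⇒ instantiate σ Q

truth : Vec Bool n → Schema n → Bool
truth ρ ⊥ₛ       = false
truth ρ (‵ i)    = lookup ρ i
truth ρ (P ⇒ₛ Q) = not (truth ρ P) or truth ρ Q

truth-instantiate : ∀ v (σ : Vec Fm n) P →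
  eval v (instantiate σ P) ≡ truth (Vec.map (eval v) σ) P
truth-instantiate v σ ⊥ₛ       = refl
truth-instantiate v σ (‵ i)    = sym (lookup-map i (eval v) σ)
truth-instantiate v σ (P ⇒ₛ Q) =
  cong₂ (λ a b → not a or b) (truth-instantiate v σ P) (truth-instantiate v σ Q)

everywhere : ∀ n → (Vec Bool n → Bool) → Bool
everywhere zero    f = f []
everywhere (suc n) f = everywhere n (f ∘ (true ∷_)) and everywhere n (f ∘ (false ∷_))

everywhere-sound : ∀ n f → T (everywhere n f) → ∀ ρ → T (f ρ)
everywhere-sound zero    f ok [] = ok
everywhere-sound (suc n) f ok (true ∷ ρ)  =
  everywhere-sound n _ (proj₁ (Equivalence.to T-∧ ok)) ρ
everywhere-sound (suc n) f ok (false ∷ ρ) =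
  everywhere-sound n _ (proj₂ (Equivalence.to T-∧ ok)) ρ

-- A schema is valid when its truth table is constantly true; this is
-- decided by evaluation, so validity of a concrete schema is checked by Agda.
Valid : Schema n → Set
Valid {n} P = T (everywhere n (λ ρ → truth ρ P))

tautology : (P : Schema n) {valid : Valid P} (σ : Vec Fm n) → X ⊢ instantiate σ P
tautology {n} P {valid} σ = taut λ v →
  trans (truth-instantiate v σ P)
        (Equivalence.to T-≡ (everywhere-sound n _ valid (Vec.map (eval v) σ)))

infixl 5 _·_

_·_ : X ⊢ (P ⇒ Q) → X ⊢ P → X ⊢ Q
_·_ = mp

∧-intro : X ⊢ P → X ⊢ Q → X ⊢ (P ∧' Q)
∧-intro {P = P} {Q = Q} p q = tautology (x₀ ⇒ₛ x₁ ⇒ₛ x₀ ∧ₛ x₁) (P ∷ Q ∷ []) · p · q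

□-mono : X ⊢ (P ⇒ Q) → X ⊢ (□ P ⇒ □ Q)
□-mono d = axK · nec d

J1-rule : X ⊢ (P ⇒ Q) → X ⊢ (P ▷ Q)
J1-rule d = axJ1 · nec d

J2-rule : X ⊢ (P ▷ Q) → X ⊢ (Q ▷ R) → X ⊢ (P ▷ R)
J2-rule pq qr = axJ2 · ∧-intro pq qr

J3-rule : X ⊢ (P ▷ R) → X ⊢ (Q ▷ R) → X ⊢ ((P ∨' Q) ▷ R)
J3-rule pr qr = axJ3 · ∧-intro pr qr

-- B ▷ B ∧ □¬B: every B-world sees a B-world with no further B-successors.
-- By Löb, □¬(B ∧ □¬B) ⊢ □¬B, so B ⊢ (B ∧ □¬B) ∨ ◇(B ∧ □¬B); then J5.
▷-löb : ∀ B → X ⊢ (B ▷ (B ∧' □ (~ B)))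
▷-löb B = J2-rule (J1-rule cases) (J3-rule (J1-rule (tautology (x₀ ⇒ₛ x₀) (K ∷ []))) axJ5)
  where
  K : Fm
  K = B ∧' □ (~ B)

  löb-step : X ⊢ (□ (~ K) ⇒ □ (~ B))
  löb-step =
    tautology ((x₀ ⇒ₛ x₁) ⇒ₛ (x₁ ⇒ₛ x₂) ⇒ₛ x₀ ⇒ₛ x₂) (□ (~ K) ∷ □ (□ (~ B) ⇒ ~ B) ∷ □ (~ B) ∷ [])
      · □-mono (tautology (~ₛ (x₀ ∧ₛ x₁) ⇒ₛ x₁ ⇒ₛ ~ₛ x₀) (B ∷ □ (~ B) ∷ []))
      · axL

  cases : X ⊢ (B ⇒ K ∨' ◇ K)
  cases = tautology ((x₂ ⇒ₛ x₁) ⇒ₛ x₀ ⇒ₛ (x₀ ∧ₛ x₁) ∨ₛ ~ₛ x₂) (B ∷ □ (~ B) ∷ □ (~ K) ∷ [])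
            · löb-step

⋀-++ : ∀ L M → X ⊢ (⋀ (L ++ M) ⇒ ⋀ L ∧' ⋀ M)
⋀-++ []      M = tautology (x₀ ⇒ₛ ⊤ₛ ∧ₛ x₀) (⋀ M ∷ [])
⋀-++ (A ∷ L) M =
  tautology ((x₁ ⇒ₛ x₂ ∧ₛ x₃) ⇒ₛ x₀ ∧ₛ x₁ ⇒ₛ (x₀ ∧ₛ x₂) ∧ₛ x₃) (A ∷ ⋀ (L ++ M) ∷ ⋀ L ∷ ⋀ M ∷ [])
    · ⋀-++ L M

⋁-inl : ∀ L M → X ⊢ (⋁ L ⇒ ⋁ (L ++ M))
⋁-inl []      M = tautology (⊥ₛ ⇒ₛ x₀) (⋁ M ∷ [])
⋁-inl (A ∷ L) M =
  tautology ((x₁ ⇒ₛ x₂) ⇒ₛ x₀ ∨ₛ x₁ ⇒ₛ x₀ ∨ₛ x₂) (A ∷ ⋁ L ∷ ⋁ (L ++ M) ∷ []) · ⋁-inl L M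

⋁-inr : ∀ L M → X ⊢ (⋁ M ⇒ ⋁ (L ++ M))
⋁-inr []      M = tautology (x₀ ⇒ₛ x₀) (⋁ M ∷ [])
⋁-inr (A ∷ L) M =
  tautology ((x₁ ⇒ₛ x₂) ⇒ₛ x₁ ⇒ₛ x₀ ∨ₛ x₂) (A ∷ ⋁ M ∷ ⋁ (L ++ M) ∷ []) · ⋁-inr L M

insert : Fm → FmSet → FmSet
insert A Γ C = C ≡ A ⊎ Γ C

discharge : ∀ L → All (insert Q Γ) L →
  Σ (List Fm) λ L' → All Γ L' × X ⊢ (⋀ L' ⇒ Q ⇒ ⋀ L)
discharge {Q} [] [] = [] , [] , tautology (x₀ ⇒ₛ x₁ ⇒ₛ x₀) (⊤' ∷ Q ∷ [])
discharge {Q} (_ ∷ L) (inj₁ refl ∷ as) with discharge L as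
... | L' , as' , d =
  L' , as' , tautology ((x₀ ⇒ₛ x₁ ⇒ₛ x₂) ⇒ₛ x₀ ⇒ₛ x₁ ⇒ₛ x₁ ∧ₛ x₂) (⋀ L' ∷ Q ∷ ⋀ L ∷ []) · d
discharge {Q} (A ∷ L) (inj₂ a ∷ as) with discharge L as
... | L' , as' , d =
  A ∷ L' , a ∷ as' ,
  tautology ((x₁ ⇒ₛ x₂ ⇒ₛ x₃) ⇒ₛ x₀ ∧ₛ x₁ ⇒ₛ x₂ ⇒ₛ x₀ ∧ₛ x₃) (A ∷ ⋀ L' ∷ Q ∷ ⋀ L ∷ []) · d

consistent-⊆ : Γ ⊆ Θ → Consistent X Θ → Consistent X Γ
consistent-⊆ sub c (L , as , d) = c (L , All.map sub as , d)

module MaximalConsistent {X : Fm → Set} {Γ : FmSet} (mcs : MCS X Γ) where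

  -- Γ contains everything derivable from finitely many of its members:
  -- adding such a formula keeps Γ consistent, so maximality applies.
  closed : ∀ L → All Γ L → X ⊢ (⋀ L ⇒ Q) → Γ Q
  closed {Q} L as d = proj₂ mcs (insert Q Γ) inj₂ consistent (inj₁ refl)
    where
    consistent : Consistent X (insert Q Γ)
    consistent (K , ks , ¬K) with discharge K ks
    ... | K' , ks' , d' = proj₁ mcs (L ++ K' , ++⁺ as ks' ,
      tautology ((x₀ ⇒ₛ x₁ ∧ₛ x₂) ⇒ₛ (x₁ ⇒ₛ x₃) ⇒ₛ (x₂ ⇒ₛ x₃ ⇒ₛ x₄) ⇒ₛ ~ₛ x₄ ⇒ₛ ~ₛ x₀)
                (⋀ (L ++ K') ∷ ⋀ L ∷ ⋀ K' ∷ Q ∷ ⋀ K ∷ [])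
        · ⋀-++ L K' · d · d' · ¬K)

  theorem : X ⊢ Q → Γ Q
  theorem {Q} d = closed [] [] (tautology (x₀ ⇒ₛ ⊤ₛ ⇒ₛ x₀) (Q ∷ []) · d)

  closed₂ : Γ P → Γ Q → X ⊢ (P ∧' Q ⇒ R) → Γ R
  closed₂ {P} {Q} {R} p q d = closed (P ∷ Q ∷ []) (p ∷ q ∷ [])
    (tautology ((x₀ ∧ₛ x₁ ⇒ₛ x₂) ⇒ₛ x₀ ∧ₛ x₁ ∧ₛ ⊤ₛ ⇒ₛ x₂) (P ∷ Q ∷ R ∷ []) · d)

  not-both : Γ (~ P) → Γ P → ⊥
  not-both {P} ¬p p =
    proj₁ mcs (~ P ∷ P ∷ [] , ¬p ∷ p ∷ [] , tautology (~ₛ (~ₛ x₀ ∧ₛ x₀ ∧ₛ ⊤ₛ)) (P ∷ []))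

  ▷-intro : X ⊢ (P ⇒ Q) → Γ (P ▷ Q)
  ▷-intro = theorem ∘ J1-rule

  ▷-trans : Γ (P ▷ Q) → Γ (Q ▷ R) → Γ (P ▷ R)
  ▷-trans pq qr = closed₂ pq qr axJ2

  ▷-join : Γ (P ▷ R) → Γ (Q ▷ R) → Γ ((P ∨' Q) ▷ R)
  ▷-join pr qr = closed₂ pr qr axJ3

-- Formulas are coded injectively by numbers: a formula is written as a
-- postfix token stream, which is then written as a binary numeral.

tokens : Fm → List ℕ → List ℕ
tokens ⊥'      ts = 0 ∷ ts
tokens (A ⇒ B) ts = tokens A (tokens B (1 ∷ ts))
tokens (□ A)   ts = tokens A (2 ∷ ts)
tokens (A ▷ B) ts = tokens A (tokens B (3 ∷ ts))
tokens (var i) ts = 4 + i ∷ ts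

push : List Fm → ℕ → List Fm
push stack           0       = ⊥' ∷ stack
push stack (suc (suc (suc (suc i)))) = var i ∷ stack
push (B ∷ A ∷ stack) 1       = (A ⇒ B) ∷ stack
push (A ∷ stack)     2       = □ A ∷ stack
push (B ∷ A ∷ stack) 3       = (A ▷ B) ∷ stack
push stack           _       = stack

parse-tokens : ∀ A stack ts → foldl push stack (tokens A ts) ≡ foldl push (A ∷ stack) ts
parse-tokens ⊥'      stack ts = refl
parse-tokens (var i) stack ts = refl
parse-tokens (A ⇒ B) stack ts =
  trans (parse-tokens A stack _) (parse-tokens B (A ∷ stack) (1 ∷ ts))
parse-tokens (□ A)   stack ts = parse-tokens A stack (2 ∷ ts)
parse-tokens (A ▷ B) stack ts =
  trans (parse-tokens A stack _) (parse-tokens B (A ∷ stack) (3 ∷ ts))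

tokens-injective : tokens A [] ≡ tokens B [] → A ≡ B
tokens-injective {A} {B} e = ∷-injectiveˡ $ begin
  A ∷ []                      ≡⟨ sym (parse-tokens A [] []) ⟩
  foldl push [] (tokens A []) ≡⟨ cong (foldl push []) e ⟩
  foldl push [] (tokens B []) ≡⟨ parse-tokens B [] [] ⟩
  B ∷ []                      ∎
  where open ≡-Reasoning

-- Lists of numbers as bijective-binary numerals: k is written as a block of
-- k digits 2 terminated by a digit 1, so blocks can be read back uniquely.
block : ℕ → ℕᵇ → ℕᵇ
block zero    b = 1+[2 b ]
block (suc k) b = 2[1+ block k b ]

block-injective : ∀ {i j b c} → block i b ≡ block j c → i ≡ j × b ≡ c
block-injective {zero}  {zero}  e = refl , 1+[2_]-injective e
block-injective {zero}  {suc j} ()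
block-injective {suc i} {zero}  ()
block-injective {suc i} {suc j} e with block-injective (2[1+_]-injective e)
... | refl , b≡c = refl , b≡c

numeral : List ℕ → ℕᵇ
numeral []       = 0ᵇ
numeral (k ∷ ks) = block k (numeral ks)

numeral-injective : ∀ ks ls → numeral ks ≡ numeral ls → ks ≡ ls
numeral-injective []       []       _ = refl
numeral-injective []       (zero  ∷ ls) ()
numeral-injective []       (suc _ ∷ ls) ()
numeral-injective (zero  ∷ ks) [] ()
numeral-injective (suc _ ∷ ks) [] ()
numeral-injective (k ∷ ks) (l ∷ ls) e with block-injective {k} {l} e
... | refl , e' = cong (k ∷_) (numeral-injective ks ls e')

code : Fm → ℕ
code A = toℕ (numeral (tokens A []))

code-injective : code A ≡ code B → A ≡ B
code-injective {A} {B} =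
  tokens-injective ∘ numeral-injective (tokens A []) (tokens B []) ∘ toℕ-injective

module Lindenbaum (X : Fm → Set) (Θ : FmSet) (Θ-consistent : Consistent X Θ) where

  mutual
    stage : ℕ → FmSet
    stage zero    A = Θ A
    stage (suc n) A = stage n A ⊎ Added n A

    Added : ℕ → Fm → Set
    Added n A = code A ≡ n × Consistent X (insert A (stage n))

  -- At most one formula is added per stage, so a finite subset of stage n + 1
  -- lies in stage n, possibly together with that formula.
  finite-stage : ∀ n L → All (stage (suc n)) L →
    All (stage n) L ⊎ Σ Fm λ A → Added n A × All (insert A (stage n)) L
  finite-stage n []      []       = inj₁ []
  finite-stage n (B ∷ L) (b ∷ bs) with b | finite-stage n L bs
  ... | inj₁ old | inj₁ olds              = inj₁ (old ∷ olds)
  ... | inj₁ old | inj₂ (A , added , as)  = inj₂ (A , added , inj₂ old ∷ as)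
  ... | inj₂ new | inj₁ olds              = inj₂ (B , new , inj₁ refl ∷ All.map inj₂ olds)
  ... | inj₂ new | inj₂ (A , added , as)  =
    inj₂ (A , added , inj₁ (code-injective (trans (proj₁ new) (sym (proj₁ added)))) ∷ as)

  stage-consistent : ∀ n → Consistent X (stage n)
  stage-consistent zero = Θ-consistent
  stage-consistent (suc n) (L , as , d) with finite-stage n L as
  ... | inj₁ olds                         = stage-consistent n (L , olds , d)
  ... | inj₂ (_ , (_ , consistent) , as') = consistent (L , as' , d)

  stage-mono : ∀ {m n} → m ≤′ n → stage m ⊆ stage n
  stage-mono ≤′-refl      a = a
  stage-mono (≤′-step m≤n) a = inj₁ (stage-mono m≤n a)

  limit : FmSet
  limit A = Σ ℕ λ n → stage n A

  finite-limit : ∀ L → All limit L → Σ ℕ λ n → All (stage n) L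
  finite-limit []      []               = 0 , []
  finite-limit (A ∷ L) ((m , a) ∷ as) with finite-limit L as
  ... | n , as' = m ⊔ n , stage-mono (≤⇒≤′ (m≤m⊔n m n)) a
                        ∷ All.map (stage-mono (≤⇒≤′ (m≤n⊔m m n))) as'

  limit-consistent : Consistent X limit
  limit-consistent (L , as , d) with finite-limit L as
  ... | n , as' = stage-consistent n (L , as' , d)

  -- A formula consistent with the limit was added at the stage of its code.
  limit-maximal : (Θ' : FmSet) → limit ⊆ Θ' → Consistent X Θ' → Θ' ⊆ limit
  limit-maximal Θ' sub consistent {A} a =
    suc (code A) , inj₂ (refl , consistent-⊆ into consistent)
    where
    into : insert A (stage (code A)) ⊆ Θ'
    into (inj₁ refl) = a
    into (inj₂ s)    = sub (code A , s)

lindenbaum : Consistent X Θ → Σ FmSet λ Δ → MCS X Δ × Θ ⊆ Δ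
lindenbaum {X} {Θ} consistent =
  limit , (limit-consistent , limit-maximal) , (λ a → 0 , a)
  where open Lindenbaum X Θ consistent

Critical : FmSet → FmSet → FmSet
Critical Γ S D = Σ (List Fm) λ S' → All S S' × Γ (~ D ▷ ⋁ (map ~ S'))

≺-critical : Γ ≺[ S ] Δ → Critical Γ S ⊆ Δ
≺-critical prec (S' , s , c) = proj₁ (prec _ S' s c)

module CriticalFormulas {X : Fm → Set} {Γ : FmSet} (mcs : MCS X Γ) (S : FmSet) where
  open MaximalConsistent mcs

  critical-pull : Γ (~ D ▷ ~ E) → Critical Γ S E → Critical Γ S D
  critical-pull de (S' , s , e) = S' , s , ▷-trans de e

  critical-⊤ : Critical Γ S ⊤'
  critical-⊤ = [] , [] , ▷-intro (tautology (~ₛ ⊤ₛ ⇒ₛ ⊥ₛ) [])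

  -- ¬(D ∧ E) is ¬D ∨ ¬E, and by J3 it interprets the union of both witnesses.
  critical-∧ : Critical Γ S D → Critical Γ S E → Critical Γ S (D ∧' E)
  critical-∧ {D} {E} (S₁ , s₁ , d) (S₂ , s₂ , e) =
    S₁ ++ S₂ , ++⁺ s₁ s₂ , subst (λ F → Γ (~ (D ∧' E) ▷ ⋁ F)) (sym (map-++ ~ S₁ S₂)) both
    where
    both : Γ (~ (D ∧' E) ▷ ⋁ (map ~ S₁ ++ map ~ S₂))
    both = ▷-trans (▷-intro (tautology (~ₛ (x₀ ∧ₛ x₁) ⇒ₛ ~ₛ x₀ ∨ₛ ~ₛ x₁) (D ∷ E ∷ [])))
                   (▷-join (▷-trans d (▷-intro (⋁-inl (map ~ S₁) (map ~ S₂))))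
                           (▷-trans e (▷-intro (⋁-inr (map ~ S₁) (map ~ S₂)))))

  critical-⋀ : ∀ {L} → All (Critical Γ S) L → Critical Γ S (⋀ L)
  critical-⋀ []       = critical-⊤
  critical-⋀ (c ∷ cs) = critical-∧ c (critical-⋀ cs)

  -- ¬□D implies ◇¬D, which interprets ¬D by J5.
  critical-□ : Critical Γ S D → Critical Γ S (□ D)
  critical-□ {D} = critical-pull (▷-trans (▷-intro ¬□⇒◇¬) (theorem axJ5))
    where
    ¬□⇒◇¬ : X ⊢ (~ (□ D) ⇒ ◇ (~ D))
    ¬□⇒◇¬ = tautology ((x₀ ⇒ₛ x₁) ⇒ₛ ~ₛ x₁ ⇒ₛ ~ₛ x₀) (□ (~ (~ D)) ∷ □ D ∷ [])
              · □-mono (tautology (~ₛ (~ₛ x₀) ⇒ₛ x₀) (D ∷ []))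

  ≺-intro : Critical Γ S ⊆ Δ → Γ ≺[ S ] Δ
  ≺-intro sub D S' s c = sub (S' , s , c) , sub (critical-□ (S' , s , c))

  seed-consistent : MCS X Δ → Γ (A ▷ B) → Γ ≺[ S ] Δ → Δ A →
    Consistent X (insert B (insert (□ (~ B)) (Critical Γ S)))
  seed-consistent {Δ} {A} {B} mΔ ab prec a (L , as , ¬L) with discharge L as
  ... | L₁ , as₁ , d₁ with discharge L₁ as₁
  ... | L₂ , as₂ , d₂ =
    MaximalConsistent.not-both mΔ (≺-critical {Γ = Γ} {S = S} prec ¬A-critical) a
    where
    refute : X ⊢ (B ∧' □ (~ B) ⇒ ~ (⋀ L₂))
    refute = tautology ((x₀ ⇒ₛ x₁ ⇒ₛ x₂) ⇒ₛ (x₂ ⇒ₛ x₃ ⇒ₛ x₄) ⇒ₛ ~ₛ x₄ ⇒ₛ x₃ ∧ₛ x₁ ⇒ₛ ~ₛ x₀)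
                       (⋀ L₂ ∷ □ (~ B) ∷ ⋀ L₁ ∷ B ∷ ⋀ L ∷ [])
               · d₂ · d₁ · ¬L

    chain : Γ (~ (~ A) ▷ ~ (⋀ L₂))
    chain = ▷-trans (▷-intro (tautology (~ₛ (~ₛ x₀) ⇒ₛ x₀) (A ∷ [])))
              (▷-trans ab (▷-trans (theorem (▷-löb B)) (▷-intro refute)))

    ¬A-critical : Critical Γ S (~ A)
    ¬A-critical = critical-pull chain (critical-⋀ as₂)

lemma5p4 : (X : Fm → Set) (Γ Δ S : Fm → Set) (A B : Fm) →
    MCS X Γ → MCS X Δ → Γ (A ▷ B) → Γ ≺[ S ] Δ → Δ A →
    Σ (Fm → Set) (λ Δ' → MCS X Δ' × Γ ≺[ S ] Δ' × Δ' B × Δ' (□ (~ B)))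
lemma5p4 X Γ Δ S A B mΓ mΔ ab prec a =
  let open CriticalFormulas mΓ S
      Δ' , mΔ' , seed⊆Δ' = lindenbaum (seed-consistent mΔ ab prec a)
  in Δ' , mΔ' , ≺-intro (λ c → seed⊆Δ' (inj₂ (inj₂ c)))
          , seed⊆Δ' (inj₁ refl) , seed⊆Δ' (inj₂ (inj₁ refl))
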